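{- Let $H$ be a Hadamard matrix of order $n$ with rows $r_1,\dots,r_n$, let $C_i=r_i^\top r_i$ ($1\le i\le n$) and $C_0=O_n$. Let $\ell$ be an odd integer with $1<\ell<n-1$, and suppose that $\sum_{i=1}^\ell C_i=\ell I_n+aA+b(J_n-A-I_n)$ for integers $a\neq b$ and a symmetric $(0,1)$-matrix $A$ with zero diagonal, and that $C_iJ_n=O_n$ for $i=1,\dots,\ell$. Let $L=(L_{i,j})$ be a symmetric Latin square of order $\ell+1$ on the symbol set $\{0,1,\dots,\ell\}$ with all diagonal entries equal to $0$, and let $\tilde L=(C_{L_{i,j}})_{i,j}$ be the $(\ell+1)n\times(\ell+1)n$ block matrix. Define $A_0=I_{(\ell+1)n}$, $A_1=I_{\ell+1}\otimes A$, $A_2=I_{\ell+1}\otimes(J_n-A-I_n)$, and let $A_3,A_4$ be the $(0,1)$-matrices with disjoint supports such that $\tilde L=A_3-A_4$. Then $\{A_0,A_1,A_2,A_3,A_4\}$ is a symmetric association scheme with $4$ classes.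
   Context: A Hadamard matrix of order $n$ is an $n\times n$ $\{1,-1\}$-matrix $H$ with $HH^\top=nI_n$; $J_n$ is the all-ones and $O_n$ the zero matrix. A $d$-class commutative association scheme on a finite set $X$ is a set of nonzero $(0,1)$-matrices $A_0,\dots,A_d$ indexed by $X$ with $A_0=I$, $\sum_i A_i=J$, each $A_i^\top\in\{A_0,\dots,A_d\}$ (with $A_i^\top\ne A_0$ for $i\ge1$), $A_iA_j=\sum_k p_{i,j}^kA_k$ for nonnegative integers $p_{i,j}^k$, and $A_iA_j=A_jA_i$; it is symmetric if all $A_i$ are symmetric, non-symmetric otherwise. -}

module Defs where

open import Data.Nat as ℕ using (ℕ; zero; suc; _<_; _≤_; _∸_)
open import Data.Nat.Properties as ℕP using (<⇒≤; ≤-trans; m∸n≤m)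
open import Data.Integer as ℤ using (ℤ; +_; _+_; _*_; _-_; -_)
open import Data.Fin as Fin using (Fin; zero; suc; inject≤; remQuot)
open import Data.Product using (Σ; ∃; ∃-syntax; Σ-syntax; _×_; _,_; proj₁; proj₂)
open import Data.Sum using (_⊎_)
open import Relation.Binary.PropositionalEquality using (_≡_; _≢_)
open import Relation.Nullary using (¬_; yes; no)
open import Function.Definitions using (Injective)

Mat : ℕ → Set
Mat m = Fin m → Fin m → ℤ

sumFin : (m : ℕ) → (Fin m → ℤ) → ℤ
sumFin zero    f = + 0
sumFin (suc m) f = f zero + sumFin m (λ k → f (suc k))

Iₘ : (m : ℕ) → Mat m
Iₘ m x y with x Fin.≟ y
... | yes _ = + 1
... | no  _ = + 0

Jₘ : (m : ℕ) → Mat m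
Jₘ m x y = + 1

Oₘ : (m : ℕ) → Mat m
Oₘ m x y = + 0

transpose : {m : ℕ} → Mat m → Mat m
transpose M x y = M y x

_·_ : {m : ℕ} → Mat m → Mat m → Mat m
_·_ {m} M N x y = sumFin m (λ z → M x z * N z y)

_≐_ : {m : ℕ} → Mat m → Mat m → Set
M ≐ N = ∀ x y → M x y ≡ N x y

Is01 : {m : ℕ} → Mat m → Set
Is01 M = ∀ x y → (M x y ≡ + 0) ⊎ (M x y ≡ + 1)

IsSymmetric : {m : ℕ} → Mat m → Set
IsSymmetric M = transpose M ≐ M

IsHadamard : (n : ℕ) → Mat n → Set
IsHadamard n H =
  (∀ x y → (H x y ≡ + 1) ⊎ (H x y ≡ - (+ 1)))
  × ((H · transpose H) ≐ (λ x y → + n * Iₘ n x y))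

rowOuter : {n : ℕ} → Mat n → Fin n → Mat n
rowOuter H r x y = H r x * H r y

-- Kronecker product, indices of Fin (p * n) split as (block, inner) by remQuot.
_⊗_ : {p n : ℕ} → Mat p → Mat n → Mat (p ℕ.* n)
_⊗_ {p} {n} P Q u v with remQuot {p} n u | remQuot {p} n v
... | (i , x) | (j , y) = P i j * Q x y

blockMat : {p n : ℕ} → (Fin p → Fin p → Mat n) → Mat (p ℕ.* n)
blockMat {p} {n} B u v with remQuot {p} n u | remQuot {p} n v
... | (i , x) | (j , y) = B i j x y

IsLatinSquare : {p : ℕ} → (Fin p → Fin p → Fin p) → Set
IsLatinSquare {p} L =
  (∀ i → Injective _≡_ _≡_ (L i)) × (∀ j → Injective _≡_ _≡_ (λ i → L i j))

<∸1⇒≤ : {ℓ n : ℕ} → ℓ < n ∸ 1 → ℓ ≤ n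
<∸1⇒≤ {ℓ} {n} h = ≤-trans (<⇒≤ h) (m∸n≤m n 1)

-- The matrix C_s for symbol s ∈ {0,…,ℓ}: C_0 = O, C_(k+1) = outer product of
-- the (k+1)-th row of H (Fin index k).
symC : {ℓ n : ℕ} → ℓ ≤ n → Mat n → Fin (suc ℓ) → Mat n
symC {ℓ} {n} le H zero    = Oₘ n
symC {ℓ} {n} le H (suc k) = rowOuter H (inject≤ k le)

IsCommAssocScheme : (m d : ℕ) → (Fin (suc d) → Mat m) → Set
IsCommAssocScheme m d A =
  (∀ i → Is01 (A i))
  × (∀ i → ¬ (A i ≐ Oₘ m))
  × (A zero ≐ Iₘ m)
  × ((λ x y → sumFin (suc d) (λ i → A i x y)) ≐ Jₘ m)
  × (∀ i → ∃[ j ] (transpose (A i) ≐ A j))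
  × (∀ (i : Fin d) → ¬ (transpose (A (suc i)) ≐ A zero))
  × (∀ i j → Σ[ p ∈ (Fin (suc d) → ℕ) ] ((A i · A j) ≐ (λ x y → sumFin (suc d) (λ k → + (p k) * A k x y))))
  × (∀ i j → (A i · A j) ≐ (A j · A i))

IsSymAssocScheme : (m d : ℕ) → (Fin (suc d) → Mat m) → Set
IsSymAssocScheme m d A = IsCommAssocScheme m d A × (∀ i → IsSymmetric (A i))

five : {m : ℕ} → Mat m → Mat m → Mat m → Mat m → Mat m → Fin 5 → Mat m
five A0 A1 A2 A3 A4 zero = A0
five A0 A1 A2 A3 A4 (suc zero) = A1
five A0 A1 A2 A3 A4 (suc (suc zero)) = A2
five A0 A1 A2 A3 A4 (suc (suc (suc zero))) = A3
five A0 A1 A2 A3 A4 (suc (suc (suc (suc zero)))) = A4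

module Submission where

-- The proof has two halves.  The general half is a criterion: symmetric
-- (0,1)-matrices partitioning J, starting with I, all nonempty, form a
-- symmetric scheme as soon as every product A_i A_j is "class-constant"
-- (its entry at (u , v) depends only on the relation containing (u , v));
-- the intersection numbers are then read off at representative pairs.
-- The specific half introduces the generators E₀ = I, T = I ⊗ S, E₂ = I ⊗ J,
-- K = (J − I) ⊗ J and L̃, computes their multiplication table from the
-- orthogonality of the rows of H (C_s C_t = n δ_st C_s) and the Latin square
-- property, and shows that generators and relations span the same rational
-- space (this is where a ≠ b enters).  Class-constancy of all products then
-- propagates through linearly closed classes, and the nonemptiness of the
-- relations uses 0 < ℓ < n − 1.

open import Defs
open import Data.Nat as ℕ using (ℕ; suc; _<_; _∸_)
open import Data.Integer as ℤ using (ℤ; +_; _+_; _*_; _-_)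
open import Data.Fin as Fin using (Fin; zero; inject≤)
open import Data.Product using (∃-syntax; ∃₂; _,_; proj₁; proj₂)
open import Relation.Binary.PropositionalEquality using (_≡_; _≢_)

open import Data.Nat using (zero; _≤_; z≤n)
import Data.Nat.Properties as ℕP
open import Data.Integer using (-_; -[1+_])
import Data.Integer.Properties as ℤP
open import Data.Integer.Tactic.RingSolver using (solve-∀)
open import Data.Fin using (suc; combine; remQuot)
import Data.Fin.Properties as FinP
open import Data.Fin.Patterns using (0F; 1F; 2F; 3F; 4F)
open import Data.Fin.Permutation using (Permutation′; permutation)
open import Data.Sum using (_⊎_; inj₁; inj₂; [_,_])
open import Data.Empty using (⊥-elim)
open import Relation.Binary.PropositionalEquality
  using (refl; sym; trans; cong; cong₂; subst; subst₂; module ≡-Reasoning)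
open import Relation.Nullary using (¬_; yes; no; Dec)
open import Relation.Nullary.Negation using (contradiction)
open import Function.Definitions using (Injective)
open import Algebra.Properties.CommutativeSemigroup ℤP.+-commutativeSemigroup
  using () renaming (interchange to +-interchange)
open import Algebra.Properties.CommutativeSemigroup ℤP.*-commutativeSemigroup
  using () renaming (interchange to *-interchange; x∙yz≈y∙xz to *-left-comm)
open import Algebra.Properties.Semiring.Sum ℤP.+-*-semiring using (sum; ∑-permute)

sum-cong : ∀ m {f g : Fin m → ℤ} → (∀ k → f k ≡ g k) → sumFin m f ≡ sumFin m g
sum-cong zero    e = refl
sum-cong (suc m) e = cong₂ _+_ (e zero) (sum-cong m (λ k → e (suc k)))

-- 'sumFin' is the library's monoid sum unfolded; this gives access to the
-- library's invariance of sums under permutations.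
sumFin≡sum : ∀ m (f : Fin m → ℤ) → sumFin m f ≡ sum f
sumFin≡sum zero    f = refl
sumFin≡sum (suc m) f = cong (λ t → f zero + t) (sumFin≡sum m (λ k → f (suc k)))

sum-+ : ∀ m (f g : Fin m → ℤ) → sumFin m (λ k → f k + g k) ≡ sumFin m f + sumFin m g
sum-+ zero    f g = refl
sum-+ (suc m) f g = begin
  (f zero + g zero) + sumFin m (λ k → f (suc k) + g (suc k))
    ≡⟨ cong (λ t → (f zero + g zero) + t) (sum-+ m (λ k → f (suc k)) (λ k → g (suc k))) ⟩
  (f zero + g zero) + (sumFin m (λ k → f (suc k)) + sumFin m (λ k → g (suc k)))
    ≡⟨ +-interchange (f zero) (g zero) _ _ ⟩
  (f zero + sumFin m (λ k → f (suc k))) + (g zero + sumFin m (λ k → g (suc k))) ∎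
  where open ≡-Reasoning

sum-*ˡ : ∀ m c (f : Fin m → ℤ) → sumFin m (λ k → c * f k) ≡ c * sumFin m f
sum-*ˡ zero    c f = sym (ℤP.*-zeroʳ c)
sum-*ˡ (suc m) c f =
  trans (cong (λ t → c * f zero + t) (sum-*ˡ m c (λ k → f (suc k))))
        (sym (ℤP.*-distribˡ-+ c (f zero) _))

sum-*ʳ : ∀ m c (f : Fin m → ℤ) → sumFin m (λ k → f k * c) ≡ sumFin m f * c
sum-*ʳ m c f =
  trans (sum-cong m (λ k → ℤP.*-comm (f k) c)) (trans (sum-*ˡ m c f) (ℤP.*-comm c _))

sum-zero : ∀ m {f : Fin m → ℤ} → (∀ k → f k ≡ + 0) → sumFin m f ≡ + 0
sum-zero zero    e = refl
sum-zero (suc m) e = cong₂ _+_ (e zero) (sum-zero m (λ k → e (suc k)))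

sum-const : ∀ m c → sumFin m (λ _ → c) ≡ + m * c
sum-const zero    c = sym (ℤP.*-zeroˡ c)
sum-const (suc m) c = begin
  c + sumFin m (λ _ → c) ≡⟨ cong (λ t → c + t) (sum-const m c) ⟩
  c + + m * c            ≡⟨ cong (_+ + m * c) (sym (ℤP.*-identityˡ c)) ⟩
  + 1 * c + + m * c      ≡⟨ sym (ℤP.*-distribʳ-+ c (+ 1) (+ m)) ⟩
  + suc m * c            ∎
  where open ≡-Reasoning

sum-swap : ∀ m n (f : Fin m → Fin n → ℤ) →
  sumFin m (λ i → sumFin n (f i)) ≡ sumFin n (λ j → sumFin m (λ i → f i j))
sum-swap zero    n f = sym (sum-zero n (λ _ → refl))
sum-swap (suc m) n f =
  trans (cong (λ t → sumFin n (f zero) + t) (sum-swap m n (λ i → f (suc i))))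
        (sym (sum-+ n (f zero) (λ j → sumFin m (λ i → f (suc i) j))))

sum-nonneg : ∀ m (f : Fin m → ℤ) → (∀ k → + 0 ℤ.≤ f k) → + 0 ℤ.≤ sumFin m f
sum-nonneg zero    f h = ℤ.+≤+ z≤n
sum-nonneg (suc m) f h = ℤP.+-mono-≤ (h zero) (sum-nonneg m (λ k → f (suc k)) (λ k → h (suc k)))

sum-↑ : ∀ m n (f : Fin (m ℕ.+ n) → ℤ) →
  sumFin (m ℕ.+ n) f ≡ sumFin m (λ k → f (k Fin.↑ˡ n)) + sumFin n (λ k → f (m Fin.↑ʳ k))
sum-↑ zero    n f = sym (ℤP.+-identityˡ _)
sum-↑ (suc m) n f =
  trans (cong (λ t → f zero + t) (sum-↑ m n (λ k → f (suc k)))) (sym (ℤP.+-assoc (f zero) _ _))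

sum-combine : ∀ p n (g : Fin (p ℕ.* n) → ℤ) →
  sumFin (p ℕ.* n) g ≡ sumFin p (λ i → sumFin n (λ x → g (combine i x)))
sum-combine zero    n g = refl
sum-combine (suc p) n g =
  trans (sum-↑ n (p ℕ.* n) g) (cong (λ t → sumFin n (λ x → g (combine {suc p} zero x)) + t)
                                    (sum-combine p n (λ k → g (n Fin.↑ʳ k))))

injective⇒surjective : ∀ {m} (σ : Fin m → Fin m) → Injective _≡_ _≡_ σ → ∀ s → ∃[ k ] σ k ≡ s
injective⇒surjective {zero}  σ inj ()
injective⇒surjective {suc m} σ inj s with FinP.any? (λ k → σ k Fin.≟ s)
... | yes found = found
... | no missed
  with FinP.pigeonhole (ℕP.n<1+n m) (λ k → Fin.punchOut {i = s} (λ e → missed (k , sym e)))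
... | (i , j , i<j , e) =
  contradiction (inj (FinP.punchOut-injective (λ e → missed (i , sym e)) (λ e → missed (j , sym e)) e))
                (FinP.<⇒≢ i<j)

sum-permute : ∀ m (σ : Fin m → Fin m) → Injective _≡_ _≡_ σ → (f : Fin m → ℤ) →
  sumFin m (λ k → f (σ k)) ≡ sumFin m f
sum-permute m σ inj f = begin
  sumFin m (λ k → f (σ k)) ≡⟨ sumFin≡sum m _ ⟩
  sum (λ k → f (σ k))      ≡⟨ sym (∑-permute f π) ⟩
  sum f                    ≡⟨ sym (sumFin≡sum m f) ⟩
  sumFin m f               ∎
  where
  open ≡-Reasoning
  σ⁻¹ : Fin m → Fin m
  σ⁻¹ s = proj₁ (injective⇒surjective σ inj s)
  π : Permutation′ m
  π = permutation σ σ⁻¹ (λ s → proj₂ (injective⇒surjective σ inj s))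
                        (λ k → inj (proj₂ (injective⇒surjective σ inj (σ k))))

I-diag : ∀ {m} (x : Fin m) → Iₘ m x x ≡ + 1
I-diag x with x Fin.≟ x
... | yes _  = refl
... | no x≢x = contradiction refl x≢x

I-off : ∀ {m} {x y : Fin m} → x ≢ y → Iₘ m x y ≡ + 0
I-off {m} {x} {y} x≢y with x Fin.≟ y
... | yes x≡y = contradiction x≡y x≢y
... | no _    = refl

I-sym : ∀ {m} → IsSymmetric (Iₘ m)
I-sym x y with y Fin.≟ x
... | yes refl = sym (I-diag x)
... | no y≢x   = sym (I-off (λ x≡y → y≢x (sym x≡y)))

I-injective : ∀ {m k} (f : Fin m → Fin k) → Injective _≡_ _≡_ f →
  ∀ x y → Iₘ k (f x) (f y) ≡ Iₘ m x y
I-injective f inj x y with x Fin.≟ y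
... | yes refl = I-diag (f x)
... | no x≢y   = I-off (λ e → x≢y (inj e))

I-one⇒≡ : ∀ {m} (x y : Fin m) → Iₘ m x y ≡ + 1 → x ≡ y
I-one⇒≡ x y e with x Fin.≟ y
... | yes x≡y = x≡y
I-one⇒≡ x y () | no _

δ-subst : ∀ {m} c (x y : Fin m) (g : Fin m → ℤ) → (c * Iₘ m x y) * g y ≡ (c * Iₘ m x y) * g x
δ-subst {m} c x y g = by-cases (x Fin.≟ y)
  where
  by-cases : Dec (x ≡ y) → (c * Iₘ m x y) * g y ≡ (c * Iₘ m x y) * g x
  by-cases (yes refl) = refl
  by-cases (no x≢y)   = begin
    (c * Iₘ m x y) * g y ≡⟨ cong (λ δ → (c * δ) * g y) (I-off x≢y) ⟩
    (c * + 0) * g y      ≡⟨ vanish c (g y) (g x) ⟩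
    (c * + 0) * g x      ≡⟨ cong (λ δ → (c * δ) * g x) (sym (I-off x≢y)) ⟩
    (c * Iₘ m x y) * g x ∎
    where
    open ≡-Reasoning
    vanish : ∀ c a b → (c * + 0) * a ≡ (c * + 0) * b
    vanish = solve-∀

sum-δ : ∀ m (i : Fin m) (f : Fin m → ℤ) → sumFin m (λ k → Iₘ m i k * f k) ≡ f i
sum-δ (suc m) zero f = begin
  + 1 * f zero + sumFin m (λ k → Iₘ (suc m) zero (suc k) * f (suc k))
    ≡⟨ cong₂ _+_ (ℤP.*-identityˡ (f zero)) (sum-zero m (λ k → off k)) ⟩
  f zero + + 0 ≡⟨ ℤP.+-identityʳ _ ⟩
  f zero       ∎
  where
  open ≡-Reasoning
  off : ∀ k → Iₘ (suc m) zero (suc k) * f (suc k) ≡ + 0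
  off k = trans (cong (_* f (suc k)) (I-off {suc m} {zero} {suc k} (λ ()))) (ℤP.*-zeroˡ (f (suc k)))
sum-δ (suc m) (suc i) f = begin
  Iₘ (suc m) (suc i) zero * f zero + sumFin m (λ k → Iₘ (suc m) (suc i) (suc k) * f (suc k))
    ≡⟨ cong₂ _+_ (trans (cong (_* f zero) (I-off {suc m} {suc i} {zero} (λ ()))) (ℤP.*-zeroˡ (f zero)))
                 (sum-cong m (λ k → cong (_* f (suc k)) (I-injective suc FinP.suc-injective i k))) ⟩
  + 0 + sumFin m (λ k → Iₘ m i k * f (suc k)) ≡⟨ ℤP.+-identityˡ _ ⟩
  sumFin m (λ k → Iₘ m i k * f (suc k))       ≡⟨ sum-δ m i (λ k → f (suc k)) ⟩
  f (suc i)                                   ∎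
  where open ≡-Reasoning

sum-δʳ : ∀ m (i : Fin m) (f : Fin m → ℤ) → sumFin m (λ k → f k * Iₘ m k i) ≡ f i
sum-δʳ m i f =
  trans (sum-cong m (λ k → trans (ℤP.*-comm (f k) _) (cong (_* f k) (I-sym i k)))) (sum-δ m i f)

Z01 : ℤ → Set
Z01 s = (s ≡ + 0) ⊎ (s ≡ + 1)

Z01-* : ∀ {s t} → Z01 s → Z01 t → Z01 (s * t)
Z01-* (inj₁ refl) _           = inj₁ refl
Z01-* (inj₂ refl) (inj₁ refl) = inj₁ refl
Z01-* (inj₂ refl) (inj₂ refl) = inj₂ refl

Z01-nonneg : ∀ {s} → Z01 s → + 0 ℤ.≤ s
Z01-nonneg (inj₁ refl) = ℤ.+≤+ z≤n
Z01-nonneg (inj₂ refl) = ℤ.+≤+ z≤n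

-- For disjoint bits, (s − t)² = s + t (used for (A₃ − A₄)∘(A₃ − A₄) = A₃ + A₄).
disjoint-square : ∀ {s t} → Z01 s → Z01 t → s * t ≡ + 0 → (s - t) * (s - t) ≡ s + t
disjoint-square (inj₁ refl) (inj₁ refl) _ = refl
disjoint-square (inj₁ refl) (inj₂ refl) _ = refl
disjoint-square (inj₂ refl) (inj₁ refl) _ = refl
disjoint-square (inj₂ refl) (inj₂ refl) ()

bit-difference-one : ∀ {s t} → Z01 s → Z01 t → s - t ≡ + 1 → s ≡ + 1
bit-difference-one (inj₂ refl) _           _  = refl
bit-difference-one (inj₁ refl) (inj₁ refl) ()
bit-difference-one (inj₁ refl) (inj₂ refl) ()

bit-difference-minus-one : ∀ {s t} → Z01 s → Z01 t → s - t ≡ - + 1 → t ≡ + 1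
bit-difference-minus-one _           (inj₂ refl) _  = refl
bit-difference-minus-one (inj₁ refl) (inj₁ refl) ()
bit-difference-minus-one (inj₂ refl) (inj₁ refl) ()

I-01 : ∀ {m} → Is01 (Iₘ m)
I-01 x y with x Fin.≟ y
... | yes _ = inj₂ refl
... | no _  = inj₁ refl

1+nonneg≢0 : ∀ {r} → + 0 ℤ.≤ r → + 1 + r ≢ + 0
1+nonneg≢0 (ℤ.+≤+ _) ()

1+nonneg≡1 : ∀ {r} → + 0 ℤ.≤ r → + 1 + r ≡ + 1 → r ≡ + 0
1+nonneg≡1 (ℤ.+≤+ {n = zero} _) refl = refl

tail-sum : ∀ m (f : Fin (suc m) → ℤ) → f zero ≡ + 0 → sumFin (suc m) f ≡ sumFin m (λ k → f (suc k))
tail-sum m f f₀≡0 = trans (cong (_+ sumFin m (λ k → f (suc k))) f₀≡0) (ℤP.+-identityˡ _)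

two-valued : ∀ {m} (f : Fin m → ℤ) {v w : ℤ} → (∀ y → (f y ≡ v) ⊎ (f y ≡ w)) →
  ¬ (∀ y → f y ≡ v) → ∃[ y ] f y ≡ w
two-valued f {v} {w} h not-const with FinP.any? (λ y → f y ℤ.≟ w)
... | yes found = found
... | no none    = ⊥-elim (not-const λ y → [ (λ e → e) , (λ e → ⊥-elim (none (y , e))) ] (h y))

01-sum-zero : ∀ m (f : Fin m → ℤ) → (∀ k → Z01 (f k)) → sumFin m f ≡ + 0 → ∀ k → f k ≡ + 0
01-sum-zero (suc m) f h e k with h zero
01-sum-zero (suc m) f h e k | inj₂ f₀≡1 =
  ⊥-elim (1+nonneg≢0 (sum-nonneg m _ (λ k → Z01-nonneg (h (suc k))))
                     (trans (cong (_+ sumFin m (λ k → f (suc k))) (sym f₀≡1)) e))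
01-sum-zero (suc m) f h e zero    | inj₁ f₀≡0 = f₀≡0
01-sum-zero (suc m) f h e (suc k) | inj₁ f₀≡0 =
  01-sum-zero m (λ k → f (suc k)) (λ k → h (suc k)) (trans (sym (tail-sum m f f₀≡0)) e) k

01-sum-one : ∀ m (f : Fin m → ℤ) → (∀ k → Z01 (f k)) → sumFin m f ≡ + 1 →
  ∃[ k₀ ] (∀ k → f k ≡ Iₘ m k k₀)
01-sum-one zero f h ()
01-sum-one (suc m) f h e with h zero
... | inj₂ f₀≡1 = zero , unit
  where
  rest-zero : ∀ k → f (suc k) ≡ + 0
  rest-zero = 01-sum-zero m (λ k → f (suc k)) (λ k → h (suc k))
    (1+nonneg≡1 (sum-nonneg m _ (λ k → Z01-nonneg (h (suc k))))
                (trans (cong (_+ sumFin m (λ k → f (suc k))) (sym f₀≡1)) e))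
  unit : ∀ k → f k ≡ Iₘ (suc m) k zero
  unit zero    = trans f₀≡1 (sym (I-diag {suc m} zero))
  unit (suc k) = trans (rest-zero k) (sym (I-off {suc m} {suc k} {zero} (λ ())))
... | inj₁ f₀≡0 with 01-sum-one m (λ k → f (suc k)) (λ k → h (suc k)) (trans (sym (tail-sum m f f₀≡0)) e)
...   | k₀ , rest-unit = suc k₀ , unit
  where
  unit : ∀ k → f k ≡ Iₘ (suc m) k (suc k₀)
  unit zero    = trans f₀≡0 (sym (I-off {suc m} {zero} {suc k₀} (λ ())))
  unit (suc k) = trans (rest-unit k) (sym (I-injective suc FinP.suc-injective k k₀))

infixl 6 _+ₘ_
infixl 7 _·ₛ_

_+ₘ_ : ∀ {m} → Mat m → Mat m → Mat m
(M +ₘ N) x y = M x y + N x y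

_·ₛ_ : ∀ {m} → ℤ → Mat m → Mat m
(c ·ₛ M) x y = c * M x y

·-congˡ : ∀ {m} {M M' : Mat m} (N : Mat m) → M ≐ M' → (M · N) ≐ (M' · N)
·-congˡ {m} N e x y = sum-cong m (λ z → cong (_* N z y) (e x z))

·-congʳ : ∀ {m} (M : Mat m) {N N' : Mat m} → N ≐ N' → (M · N) ≐ (M · N')
·-congʳ {m} M e x y = sum-cong m (λ z → cong (M x z *_) (e z y))

·-distribʳ : ∀ {m} (M M' N : Mat m) → ((M +ₘ M') · N) ≐ ((M · N) +ₘ (M' · N))
·-distribʳ {m} M M' N x y =
  trans (sum-cong m (λ z → ℤP.*-distribʳ-+ (N z y) (M x z) (M' x z))) (sum-+ m _ _)

·-distribˡ : ∀ {m} (M N N' : Mat m) → (M · (N +ₘ N')) ≐ ((M · N) +ₘ (M · N'))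
·-distribˡ {m} M N N' x y =
  trans (sum-cong m (λ z → ℤP.*-distribˡ-+ (M x z) (N z y) (N' z y))) (sum-+ m _ _)

·-scaleˡ : ∀ {m} c (M N : Mat m) → ((c ·ₛ M) · N) ≐ (c ·ₛ (M · N))
·-scaleˡ {m} c M N x y = trans (sum-cong m (λ z → ℤP.*-assoc c (M x z) (N z y))) (sum-*ˡ m c _)

·-scaleʳ : ∀ {m} c (M N : Mat m) → (M · (c ·ₛ N)) ≐ (c ·ₛ (M · N))
·-scaleʳ {m} c M N x y = trans (sum-cong m (λ z → *-left-comm (M x z) c (N z y))) (sum-*ˡ m c _)

I·M : ∀ {m} (M : Mat m) → (Iₘ m · M) ≐ M
I·M {m} M x y = sum-δ m x (λ z → M z y)

M·I : ∀ {m} (M : Mat m) → (M · Iₘ m) ≐ M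
M·I {m} M x y = sum-δʳ m y (λ z → M x z)

·-transpose : ∀ {m} {M N : Mat m} → IsSymmetric M → IsSymmetric N →
  ∀ x y → (M · N) x y ≡ (N · M) y x
·-transpose {m} {M} {N} sM sN x y =
  sum-cong m (λ z → trans (ℤP.*-comm (M x z) (N z y)) (cong₂ _*_ (sN y z) (sM z x)))

Σₘ : ∀ {m} g → (Fin g → Mat m) → Mat m
Σₘ g N x y = sumFin g (λ s → N s x y)

·-sumˡ : ∀ {m} g (N : Fin g → Mat m) (M : Mat m) → (Σₘ g N · M) ≐ Σₘ g (λ s → N s · M)
·-sumˡ {m} g N M x y =
  trans (sum-cong m (λ z → sym (sum-*ʳ g (M z y) (λ s → N s x z))))
        (sum-swap m g (λ z s → N s x z * M z y))

·-sumʳ : ∀ {m} g (M : Mat m) (N : Fin g → Mat m) → (M · Σₘ g N) ≐ Σₘ g (λ s → M · N s)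
·-sumʳ {m} g M N x y =
  trans (sum-cong m (λ z → sym (sum-*ˡ g (M x z) (λ s → N s z y))))
        (sum-swap m g (λ z s → M x z * N s z y))

≐-sym : ∀ {m} {M M' : Mat m} → M ≐ M' → M' ≐ M
≐-sym e x y = sym (e x y)

-- A class of matrices closed under the operations of a ℤ-module and under
-- division by nonzero integers (a "ℚ-subspace" of ℤ-matrices).
record LinClosed {m : ℕ} (Q : Mat m → Set) : Set where
  field
    respects : ∀ {M M'} → M ≐ M' → Q M → Q M'
    plus     : ∀ {M M'} → Q M → Q M' → Q (M +ₘ M')
    scale    : ∀ c {M} → Q M → Q (c ·ₛ M)
    cancel   : ∀ d {M} → d ≢ + 0 → Q (d ·ₛ M) → Q M

symmetric-lin : ∀ {m} → LinClosed (IsSymmetric {m})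
symmetric-lin = record
  { respects = λ e sM x y → trans (sym (e y x)) (trans (sM x y) (e x y))
  ; plus     = λ sM sM' x y → cong₂ _+_ (sM x y) (sM' x y)
  ; scale    = λ c sM x y → cong (c *_) (sM x y)
  ; cancel   = λ d {M} d≢0 sM x y → ℤP.*-cancelˡ-≡ d (M y x) (M x y) {{ℤ.≢-nonZero d≢0}} (sM x y)
  }

module _ {m : ℕ} {Q : Mat m → Set} (lin : LinClosed Q) where
  open LinClosed lin

  ·-closedʳ : (X : Mat m) → LinClosed (λ Y → Q (X · Y))
  ·-closedʳ X = record
    { respects = λ e → respects (·-congʳ X e)
    ; plus     = λ {Y} {Y'} q q' → respects (λ u v → sym (·-distribˡ X Y Y' u v)) (plus q q')
    ; scale    = λ c {Y} q → respects (λ u v → sym (·-scaleʳ c X Y u v)) (scale c q)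
    ; cancel   = λ d {Y} d≢0 q → cancel d d≢0 (respects (·-scaleʳ d X Y) q)
    }

  ·-closedˡ : (Y : Mat m) → LinClosed (λ X → Q (X · Y))
  ·-closedˡ Y = record
    { respects = λ e → respects (·-congˡ Y e)
    ; plus     = λ {X} {X'} q q' → respects (λ u v → sym (·-distribʳ X X' Y u v)) (plus q q')
    ; scale    = λ c {X} q → respects (λ u v → sym (·-scaleˡ c X Y u v)) (scale c q)
    ; cancel   = λ d {X} d≢0 q → cancel d d≢0 (respects (·-scaleˡ d X Y) q)
    }

module Classes {m d : ℕ} (𝔸 : Fin (suc d) → Mat m) where

  ClassConstant : Mat m → Set
  ClassConstant M = ∀ u v u' v' → (∀ k → 𝔸 k u v ≡ 𝔸 k u' v') → M u v ≡ M u' v'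

  classConstant-lin : LinClosed ClassConstant
  classConstant-lin = record
    { respects = λ e cc u v u' v' same → trans (sym (e u v)) (trans (cc u v u' v' same) (e u' v'))
    ; plus     = λ cc cc' u v u' v' same → cong₂ _+_ (cc u v u' v' same) (cc' u v u' v' same)
    ; scale    = λ c cc u v u' v' same → cong (c *_) (cc u v u' v' same)
    ; cancel   = λ d {M} d≢0 cc u v u' v' same →
        ℤP.*-cancelˡ-≡ d (M u v) (M u' v') {{ℤ.≢-nonZero d≢0}} (cc u v u' v' same)
    }

  relation-classConstant : ∀ k → ClassConstant (𝔸 k)
  relation-classConstant k u v u' v' same = same k

  -- For symmetric relations the pairs (u , v) and (v , u) lie in the same
  -- relations, so transposing a product of symmetric matrices keeps it class-constant.
  classConstant-swap : (∀ k → IsSymmetric (𝔸 k)) → ∀ {X Y} → IsSymmetric X → IsSymmetric Y →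
    ClassConstant (Y · X) → ClassConstant (X · Y)
  classConstant-swap 𝔸-sym {X} {Y} sX sY cc u v u' v' same = begin
    (X · Y) u v   ≡⟨ ·-transpose sX sY u v ⟩
    (Y · X) v u   ≡⟨ cc v u v' u' (λ k → trans (𝔸-sym k u v) (trans (same k) (sym (𝔸-sym k u' v')))) ⟩
    (Y · X) v' u' ≡⟨ sym (·-transpose sX sY u' v') ⟩
    (X · Y) u' v' ∎
    where open ≡-Reasoning

  -- A family of symmetric (0,1)-matrices partitioning J, starting with I,
  -- with every relation nonempty and every product class-constant, is a
  -- symmetric association scheme: the intersection numbers are the values of
  -- the products at a representative pair of each class.
  module Criterion
    (𝔸-01      : ∀ k → Is01 (𝔸 k))
    (partition : (λ x y → sumFin (suc d) (λ k → 𝔸 k x y)) ≐ Jₘ m)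
    (𝔸₀≐I     : 𝔸 zero ≐ Iₘ m)
    (𝔸-sym     : ∀ k → IsSymmetric (𝔸 k))
    (witness   : ∀ k → ∃₂ λ u v → 𝔸 k u v ≡ + 1)
    (products  : ∀ i j → ClassConstant (𝔸 i · 𝔸 j)) where

    1≢0 : + 1 ≢ + 0
    1≢0 ()

    class-of : ∀ u v → ∃[ k₀ ] (∀ k → 𝔸 k u v ≡ Iₘ (suc d) k k₀)
    class-of u v = 01-sum-one (suc d) (λ k → 𝔸 k u v) (λ k → 𝔸-01 k u v) (partition u v)

    rep₁ rep₂ : Fin (suc d) → Fin m
    rep₁ k = proj₁ (witness k)
    rep₂ k = proj₁ (proj₂ (witness k))

    rep-class : ∀ k₀ k → 𝔸 k (rep₁ k₀) (rep₂ k₀) ≡ Iₘ (suc d) k k₀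
    rep-class k₀ k with class-of (rep₁ k₀) (rep₂ k₀)
    ... | k₁ , unit with I-one⇒≡ k₀ k₁ (trans (sym (unit k₀)) (proj₂ (proj₂ (witness k₀))))
    ...   | refl = unit k

    intersection : Fin (suc d) → Fin (suc d) → Fin (suc d) → ℕ
    intersection i j k = ℤ.∣ (𝔸 i · 𝔸 j) (rep₁ k) (rep₂ k) ∣

    product-nonneg : ∀ i j u v → + 0 ℤ.≤ (𝔸 i · 𝔸 j) u v
    product-nonneg i j u v =
      sum-nonneg m _ (λ z → Z01-nonneg (Z01-* (𝔸-01 i u z) (𝔸-01 j z v)))

    expansion : ∀ i j →
      (𝔸 i · 𝔸 j) ≐ (λ x y → sumFin (suc d) (λ k → + (intersection i j k) * 𝔸 k x y))
    expansion i j u v with class-of u v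
    ... | k₀ , unit = sym (begin
      sumFin (suc d) (λ k → + (intersection i j k) * 𝔸 k u v)
        ≡⟨ sum-cong (suc d) (λ k → cong (+ (intersection i j k) *_) (unit k)) ⟩
      sumFin (suc d) (λ k → + (intersection i j k) * Iₘ (suc d) k k₀)
        ≡⟨ sum-δʳ (suc d) k₀ (λ k → + (intersection i j k)) ⟩
      + (intersection i j k₀)
        ≡⟨ ℤP.0≤i⇒+∣i∣≡i (product-nonneg i j (rep₁ k₀) (rep₂ k₀)) ⟩
      (𝔸 i · 𝔸 j) (rep₁ k₀) (rep₂ k₀)
        ≡⟨ products i j _ _ u v (λ k → trans (rep-class k₀ k) (sym (unit k))) ⟩
      (𝔸 i · 𝔸 j) u v ∎)
      where open ≡-Reasoning

    -- A_i A_j = (A_j A_i)ᵀ, and transposition fixes every class.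
    commutative : ∀ i j → (𝔸 i · 𝔸 j) ≐ (𝔸 j · 𝔸 i)
    commutative i j u v =
      trans (·-transpose (𝔸-sym i) (𝔸-sym j) u v) (products j i v u u v (λ k → 𝔸-sym k u v))

    nonempty : ∀ k → ¬ (𝔸 k ≐ Oₘ m)
    nonempty k k≐O = 1≢0 (trans (sym (proj₂ (proj₂ (witness k)))) (k≐O (rep₁ k) (rep₂ k)))

    not-identity : ∀ (i : Fin d) → ¬ (transpose (𝔸 (suc i)) ≐ 𝔸 zero)
    not-identity i tr≐𝔸₀ = 1≢0 (begin
      + 1                       ≡⟨ sym (proj₂ (proj₂ (witness (suc i)))) ⟩
      𝔸 (suc i) u v             ≡⟨ sym (𝔸-sym (suc i) u v) ⟩
      transpose (𝔸 (suc i)) u v ≡⟨ tr≐𝔸₀ u v ⟩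
      𝔸 zero u v                ≡⟨ rep-class (suc i) zero ⟩
      Iₘ (suc d) zero (suc i)   ≡⟨ I-off {suc d} {zero} {suc i} (λ ()) ⟩
      + 0                       ∎)
      where
      open ≡-Reasoning
      u = rep₁ (suc i)
      v = rep₂ (suc i)

    isSymAssocScheme : IsSymAssocScheme m d 𝔸
    isSymAssocScheme =
      ( 𝔸-01 , nonempty , 𝔸₀≐I , partition , (λ i → i , 𝔸-sym i) , not-identity
      , (λ i j → intersection i j , expansion i j) , commutative )
      , 𝔸-sym

module Blocks (p n : ℕ) where

  pair : Fin p → Fin n → Fin (p ℕ.* n)
  pair = combine

  ⊗-entry : (P : Mat p) (Q : Mat n) →
    ∀ i x j y → (P ⊗ Q) (pair i x) (pair j y) ≡ P i j * Q x y
  ⊗-entry P Q i x j y =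
    cong₂ (λ q r → P (proj₁ q) (proj₁ r) * Q (proj₂ q) (proj₂ r))
          (FinP.remQuot-combine {p} {n} i x) (FinP.remQuot-combine {p} {n} j y)

  block-entry : (B : Fin p → Fin p → Mat n) →
    ∀ i x j y → blockMat B (pair i x) (pair j y) ≡ B i j x y
  block-entry B i x j y =
    cong₂ (λ q r → B (proj₁ q) (proj₁ r) (proj₂ q) (proj₂ r))
          (FinP.remQuot-combine {p} {n} i x) (FinP.remQuot-combine {p} {n} j y)

  by-blocks : (Φ : Fin (p ℕ.* n) → Fin (p ℕ.* n) → Set) →
    (∀ i x j y → Φ (pair i x) (pair j y)) → ∀ u v → Φ u v
  by-blocks Φ h u v =
    subst₂ Φ (FinP.combine-remQuot {p} n u) (FinP.combine-remQuot {p} n v)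
      (h (proj₁ (remQuot {p} n u)) (proj₂ (remQuot {p} n u))
         (proj₁ (remQuot {p} n v)) (proj₂ (remQuot {p} n v)))

  ≐-by-blocks : {M M' : Mat (p ℕ.* n)} →
    (∀ i x j y → M (pair i x) (pair j y) ≡ M' (pair i x) (pair j y)) → M ≐ M'
  ≐-by-blocks {M} {M'} = by-blocks (λ u v → M u v ≡ M' u v)

  symmetric-by-blocks : {M : Mat (p ℕ.* n)} →
    (∀ i x j y → M (pair j y) (pair i x) ≡ M (pair i x) (pair j y)) → IsSymmetric M
  symmetric-by-blocks {M} = by-blocks (λ u v → M v u ≡ M u v)

  ·-entry : (M M' : Mat (p ℕ.* n)) → ∀ i x j y →
    (M · M') (pair i x) (pair j y)
      ≡ sumFin p (λ k → sumFin n (λ z → M (pair i x) (pair k z) * M' (pair k z) (pair j y)))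
  ·-entry M M' i x j y = sum-combine p n _

  I-entry : ∀ i x j y → Iₘ (p ℕ.* n) (pair i x) (pair j y) ≡ Iₘ p i j * Iₘ n x y
  I-entry i x j y = by-cases (i Fin.≟ j) (x Fin.≟ y)
    where
    by-cases : Dec (i ≡ j) → Dec (x ≡ y) →
      Iₘ (p ℕ.* n) (pair i x) (pair j y) ≡ Iₘ p i j * Iₘ n x y
    by-cases (yes refl) (yes refl) = trans (I-diag (pair i x)) (sym (cong₂ _*_ (I-diag i) (I-diag x)))
    by-cases (no i≢j)   _          =
      trans (I-off (λ e → i≢j (FinP.combine-injectiveˡ i x j y e)))
            (sym (trans (cong (_* Iₘ n x y) (I-off i≢j)) (ℤP.*-zeroˡ (Iₘ n x y))))
    by-cases (yes refl) (no x≢y)   =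
      trans (I-off (λ e → x≢y (FinP.combine-injectiveʳ i x i y e)))
            (sym (trans (cong (Iₘ p i i *_) (I-off x≢y)) (ℤP.*-zeroʳ (Iₘ p i i))))

  ⊗-symmetric : {P : Mat p} {Q : Mat n} → IsSymmetric P → IsSymmetric Q → IsSymmetric (P ⊗ Q)
  ⊗-symmetric {P} {Q} sP sQ = symmetric-by-blocks λ i x j y →
    trans (⊗-entry P Q j y i x) (trans (cong₂ _*_ (sP i j) (sQ x y)) (sym (⊗-entry P Q i x j y)))

  ⊗-product : ∀ α β α' β' i x j y →
    ((α ⊗ β) · (α' ⊗ β')) (pair i x) (pair j y) ≡ (α · α') i j * (β · β') x y
  ⊗-product α β α' β' i x j y = begin
    ((α ⊗ β) · (α' ⊗ β')) (pair i x) (pair j y)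
      ≡⟨ ·-entry (α ⊗ β) (α' ⊗ β') i x j y ⟩
    sumFin p (λ k → sumFin n (λ z → (α ⊗ β) (pair i x) (pair k z) * (α' ⊗ β') (pair k z) (pair j y)))
      ≡⟨ sum-cong p (λ k → sum-cong n (λ z →
           trans (cong₂ _*_ (⊗-entry α β i x k z) (⊗-entry α' β' k z j y))
                 (*-interchange (α i k) (β x z) (α' k j) (β' z y)))) ⟩
    sumFin p (λ k → sumFin n (λ z → (α i k * α' k j) * (β x z * β' z y)))
      ≡⟨ sum-cong p (λ k → sum-*ˡ n (α i k * α' k j) (λ z → β x z * β' z y)) ⟩
    sumFin p (λ k → (α i k * α' k j) * (β · β') x y)
      ≡⟨ sum-*ʳ p ((β · β') x y) (λ k → α i k * α' k j) ⟩
    (α · α') i j * (β · β') x y ∎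
    where open ≡-Reasoning

  ⊗-product-scaled : ∀ α β α' β' {γ δ} c →
    (∀ i j → (α · α') i j ≡ γ i j) → (∀ x y → (β · β') x y ≡ c * δ x y) →
    ((α ⊗ β) · (α' ⊗ β')) ≐ (c ·ₛ (γ ⊗ δ))
  ⊗-product-scaled α β α' β' {γ} {δ} c hα hβ = ≐-by-blocks λ i x j y → begin
    ((α ⊗ β) · (α' ⊗ β')) (pair i x) (pair j y) ≡⟨ ⊗-product α β α' β' i x j y ⟩
    (α · α') i j * (β · β') x y                 ≡⟨ cong₂ _*_ (hα i j) (hβ x y) ⟩
    γ i j * (c * δ x y)                         ≡⟨ *-left-comm (γ i j) c (δ x y) ⟩
    c * (γ i j * δ x y)                         ≡⟨ cong (c *_) (sym (⊗-entry γ δ i x j y)) ⟩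
    (c ·ₛ (γ ⊗ δ)) (pair i x) (pair j y)        ∎
    where open ≡-Reasoning

  ⊗-product-zero : ∀ α β α' β' → (∀ x y → (β · β') x y ≡ + 0) →
    ((α ⊗ β) · (α' ⊗ β')) ≐ Oₘ (p ℕ.* n)
  ⊗-product-zero α β α' β' hβ = ≐-by-blocks λ i x j y →
    trans (⊗-product α β α' β' i x j y)
          (trans (cong ((α · α') i j *_) (hβ x y)) (ℤP.*-zeroʳ ((α · α') i j)))

  ⊗·block : ∀ α β (B : Fin p → Fin p → Mat n) i x j y →
    ((α ⊗ β) · blockMat B) (pair i x) (pair j y) ≡ sumFin p (λ k → α i k * (β · B k j) x y)
  ⊗·block α β B i x j y = begin
    ((α ⊗ β) · blockMat B) (pair i x) (pair j y)
      ≡⟨ ·-entry (α ⊗ β) (blockMat B) i x j y ⟩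
    sumFin p (λ k → sumFin n (λ z → (α ⊗ β) (pair i x) (pair k z) * blockMat B (pair k z) (pair j y)))
      ≡⟨ sum-cong p (λ k → sum-cong n (λ z →
           trans (cong₂ _*_ (⊗-entry α β i x k z) (block-entry B k z j y)) (ℤP.*-assoc (α i k) _ _))) ⟩
    sumFin p (λ k → sumFin n (λ z → α i k * (β x z * B k j z y)))
      ≡⟨ sum-cong p (λ k → sum-*ˡ n (α i k) (λ z → β x z * B k j z y)) ⟩
    sumFin p (λ k → α i k * (β · B k j) x y) ∎
    where open ≡-Reasoning

  ⊗·block-zero : ∀ α β (B : Fin p → Fin p → Mat n) → (∀ k j x y → (β · B k j) x y ≡ + 0) →
    ((α ⊗ β) · blockMat B) ≐ Oₘ (p ℕ.* n)
  ⊗·block-zero α β B hβ = ≐-by-blocks λ i x j y →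
    trans (⊗·block α β B i x j y)
          (sum-zero p (λ k → trans (cong (α i k *_) (hβ k j x y)) (ℤP.*-zeroʳ (α i k))))

  block·block : ∀ (B B' : Fin p → Fin p → Mat n) i x j y →
    (blockMat B · blockMat B') (pair i x) (pair j y) ≡ sumFin p (λ k → (B i k · B' k j) x y)
  block·block B B' i x j y =
    trans (·-entry (blockMat B) (blockMat B') i x j y)
          (sum-cong p (λ k → sum-cong n (λ z → cong₂ _*_ (block-entry B i x k z) (block-entry B' k z j y))))

PM1 : ℤ → Set
PM1 s = (s ≡ + 1) ⊎ (s ≡ - (+ 1))

PM1-* : ∀ {s t} → PM1 s → PM1 t → PM1 (s * t)
PM1-* (inj₁ refl) (inj₁ refl) = inj₁ refl
PM1-* (inj₁ refl) (inj₂ refl) = inj₂ refl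
PM1-* (inj₂ refl) (inj₁ refl) = inj₂ refl
PM1-* (inj₂ refl) (inj₂ refl) = inj₁ refl

PM1-square : ∀ {s} → PM1 s → s * s ≡ + 1
PM1-square (inj₁ refl) = refl
PM1-square (inj₂ refl) = refl

module HadamardRows {n : ℕ} (H : Mat n) (hH : IsHadamard n H) where

  -- Orthogonality of the rows of H gives C_r C_r' = n δ(r,r') C_r.
  rowOuter-product : ∀ r r' x y →
    (rowOuter H r · rowOuter H r') x y ≡ (+ n * Iₘ n r r') * rowOuter H r x y
  rowOuter-product r r' x y = begin
    sumFin n (λ z → (H r x * H r z) * (H r' z * H r' y))
      ≡⟨ sum-cong n (λ z → regroup (H r x) (H r z) (H r' z) (H r' y)) ⟩
    sumFin n (λ z → (H r x * H r' y) * (H r z * H r' z))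
      ≡⟨ sum-*ˡ n (H r x * H r' y) (λ z → H r z * H r' z) ⟩
    (H r x * H r' y) * (H · transpose H) r r'
      ≡⟨ cong ((H r x * H r' y) *_) (proj₂ hH r r') ⟩
    (H r x * H r' y) * (+ n * Iₘ n r r')
      ≡⟨ ℤP.*-comm (H r x * H r' y) (+ n * Iₘ n r r') ⟩
    (+ n * Iₘ n r r') * (H r x * H r' y)
      ≡⟨ δ-subst (+ n) r r' (λ q → H r x * H q y) ⟩
    (+ n * Iₘ n r r') * (H r x * H r y) ∎
    where
    open ≡-Reasoning
    regroup : ∀ a b c e → (a * b) * (c * e) ≡ (a * e) * (b * c)
    regroup = solve-∀

  rowOuter-symmetric : ∀ r → IsSymmetric (rowOuter H r)
  rowOuter-symmetric r x y = ℤP.*-comm (H r y) (H r x)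

  rowOuter-±1 : ∀ r x y → PM1 (rowOuter H r x y)
  rowOuter-±1 r x y = PM1-* (proj₁ hH r x) (proj₁ hH r y)

  rowOuter-diagonal : ∀ r x → rowOuter H r x x ≡ + 1
  rowOuter-diagonal r x = PM1-square (proj₁ hH r x)

module RowSums {n ℓ : ℕ} (H : Mat n) (hH : IsHadamard n H) (le : ℓ ≤ n)
  (C·J≐O : ∀ (k : Fin ℓ) → (rowOuter H (inject≤ k le) · Jₘ n) ≐ Oₘ n) where

  open HadamardRows H hH

  C : Fin (suc ℓ) → Mat n
  C = symC le H

  S : Mat n
  S = Σₘ (suc ℓ) C

  -- C_s C_t = n δ(s,t) C_s: distinct symbols use distinct rows of H.
  C-product : ∀ s t x y → (C s · C t) x y ≡ (+ n * Iₘ (suc ℓ) s t) * C s x y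
  C-product zero t x y =
    trans (sum-zero n (λ z → refl)) (sym (ℤP.*-zeroʳ (+ n * Iₘ (suc ℓ) zero t)))
  C-product (suc k) zero x y = begin
    (C (suc k) · Oₘ n) x y ≡⟨ sum-zero n (λ z → ℤP.*-zeroʳ (C (suc k) x z)) ⟩
    + 0                    ≡⟨ sym (trans (cong (_* C (suc k) x y) (ℤP.*-zeroʳ (+ n)))
                                                                (ℤP.*-zeroˡ (C (suc k) x y))) ⟩
    (+ n * + 0) * C (suc k) x y                   ≡⟨ cong (λ δ → (+ n * δ) * C (suc k) x y)
                                                          (sym (I-off {suc ℓ} {suc k} {zero} (λ ()))) ⟩
    (+ n * Iₘ (suc ℓ) (suc k) zero) * C (suc k) x y ∎
    where open ≡-Reasoning
  C-product (suc k) (suc k') x y =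
    trans (rowOuter-product (inject≤ k le) (inject≤ k' le) x y)
          (cong (λ δ → (+ n * δ) * C (suc k) x y)
                (trans (I-injective (λ k → inject≤ k le) (λ {i} {j} → FinP.inject≤-injective le le i j) k k')
                       (sym (I-injective suc FinP.suc-injective k k'))))

  C-symmetric : ∀ s → IsSymmetric (C s)
  C-symmetric zero    x y = refl
  C-symmetric (suc k) = rowOuter-symmetric (inject≤ k le)

  C·J : ∀ s → (C s · Jₘ n) ≐ Oₘ n
  C·J zero    x y = sum-zero n (λ z → refl)
  C·J (suc k) = C·J≐O k

  J-symmetric : IsSymmetric (Jₘ n)
  J-symmetric x y = refl

  J·C : ∀ s → (Jₘ n · C s) ≐ Oₘ n
  J·C s x y = trans (·-transpose J-symmetric (C-symmetric s) x y) (C·J s y x)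

  J·J : (Jₘ n · Jₘ n) ≐ (+ n ·ₛ Jₘ n)
  J·J x y = sum-const n (+ 1)

  S-symmetric : IsSymmetric S
  S-symmetric x y = sum-cong (suc ℓ) (λ s → C-symmetric s x y)

  S·C : ∀ t → (S · C t) ≐ (+ n ·ₛ C t)
  S·C t x y = begin
    (S · C t) x y
      ≡⟨ ·-sumˡ (suc ℓ) C (C t) x y ⟩
    sumFin (suc ℓ) (λ s → (C s · C t) x y)
      ≡⟨ sum-cong (suc ℓ) (λ s → C-product s t x y) ⟩
    sumFin (suc ℓ) (λ s → (+ n * Iₘ (suc ℓ) s t) * C s x y)
      ≡⟨ sum-cong (suc ℓ) (λ s → reorder (+ n) (Iₘ (suc ℓ) s t) (C s x y)) ⟩
    sumFin (suc ℓ) (λ s → (+ n * C s x y) * Iₘ (suc ℓ) s t)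
      ≡⟨ sum-δʳ (suc ℓ) t (λ s → + n * C s x y) ⟩
    + n * C t x y ∎
    where
    open ≡-Reasoning
    reorder : ∀ a b c → (a * b) * c ≡ (a * c) * b
    reorder = solve-∀

  S·S : (S · S) ≐ (+ n ·ₛ S)
  S·S x y =
    trans (·-sumʳ (suc ℓ) S C x y)
          (trans (sum-cong (suc ℓ) (λ t → S·C t x y)) (sum-*ˡ (suc ℓ) (+ n) (λ t → C t x y)))

  S·J : (S · Jₘ n) ≐ Oₘ n
  S·J x y = trans (·-sumˡ (suc ℓ) C (Jₘ n) x y) (sum-zero (suc ℓ) (λ s → C·J s x y))

-- For 0 < ℓ < m the integer ℓ + m c never vanishes: it is positive when
-- c ≥ 0, and for c < 0 it would force ℓ = m ∣c∣ ≥ m.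
ℓ+mc≢0 : ∀ {ℓ m} → 0 < ℓ → ℓ < m → ∀ c → + ℓ + + m * c ≢ + 0
ℓ+mc≢0 {ℓ} {m} 0<ℓ ℓ<m (+ k) e =
  ℕP.<⇒≢ 0<ℓ (sym (ℕP.m+n≡0⇒m≡0 ℓ (ℤP.+-injective
    (trans (ℤP.pos-+ ℓ (m ℕ.* k)) (trans (cong (λ t → + ℓ + t) (ℤP.pos-* m k)) e)))))
ℓ+mc≢0 {ℓ} {m} 0<ℓ ℓ<m -[1+ k ] e =
  ℕP.<⇒≱ ℓ<m (subst (m ℕ.≤_) (sym ℓ≡m[k+1]) (ℕP.m≤m*n m (suc k)))
  where
  ℓ≡m[k+1] : ℓ ≡ m ℕ.* suc k
  ℓ≡m[k+1] = ℤP.+-injective (ℤP.i-j≡0⇒i≡j (+ ℓ) (+ (m ℕ.* suc k))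
    (trans (cong (λ t → + ℓ + t)
                 (trans (cong -_ (ℤP.pos-* m (suc k))) (ℤP.neg-distribʳ-* (+ m) (+ suc k))))
           e))

-- The same fact, phrased as the row sum n c + (ℓ − c) of a row that is ℓ on
-- the diagonal and c elsewhere.
row-sum≢0 : ∀ {ℓ n} → 0 < ℓ → ℓ < n ∸ 1 → ∀ c → + n * c + (+ ℓ - c) * + 1 ≢ + 0
row-sum≢0 {ℓ} {suc m} 0<ℓ ℓ<m c e = ℓ+mc≢0 0<ℓ ℓ<m c (trans (sym (regroup (+ m) (+ ℓ) c)) e)
  where
  regroup : ∀ m l c → (+ 1 + m) * c + (l - c) * + 1 ≡ l + m * c
  regroup = solve-∀

-- The construction of Theorem 5.6, under all its hypotheses except the
-- size constraints 0 < ℓ < n − 1 (needed only for the nonemptiness of the relations).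

module Construction
  {n ℓ : ℕ} (H : Mat n) (hH : IsHadamard n H) (le : ℓ ≤ n)
  (C·J≐O : ∀ (k : Fin ℓ) → (rowOuter H (inject≤ k le) · Jₘ n) ≐ Oₘ n)
  (a b : ℤ) (a≢b : a ≢ b) (A : Mat n) (A-01 : Is01 A)
  (A-diag : ∀ x → A x x ≡ + 0)
  (S-decomp : (λ x y → sumFin ℓ (λ k → rowOuter H (inject≤ k le) x y))
              ≐ (λ x y → + ℓ * Iₘ n x y + a * A x y + b * (Jₘ n x y - A x y - Iₘ n x y)))
  (L : Fin (suc ℓ) → Fin (suc ℓ) → Fin (suc ℓ)) (L-latin : IsLatinSquare L)
  (L-sym : ∀ i j → L i j ≡ L j i) (L-diag : ∀ i → L i i ≡ zero)
  (A₃ A₄ : Mat (suc ℓ ℕ.* n)) (A₃-01 : Is01 A₃) (A₄-01 : Is01 A₄)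
  (disjoint : ∀ u v → A₃ u v * A₄ u v ≡ + 0)
  (L̃≐A₃-A₄ : blockMat (λ i j → symC le H (L i j)) ≐ (λ u v → A₃ u v - A₄ u v)) where

  open RowSums H hH le C·J≐O
  open HadamardRows H hH using (rowOuter-±1; rowOuter-diagonal)

  p N : ℕ
  p = suc ℓ
  N = p ℕ.* n

  open Blocks p n

  Ā : Mat n
  Ā x y = Jₘ n x y - A x y - Iₘ n x y

  𝔸 : Fin 5 → Mat N
  𝔸 = five (Iₘ N) (Iₘ p ⊗ A) (Iₘ p ⊗ Ā) A₃ A₄

  open Classes 𝔸

  J-I : Mat p
  J-I i j = Jₘ p i j - Iₘ p i j

  E₀ T E₂ K L̃ : Mat N
  E₀ = Iₘ N
  T  = Iₘ p ⊗ S
  E₂ = Iₘ p ⊗ Jₘ n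
  K  = J-I ⊗ Jₘ n
  L̃  = blockMat (λ i j → C (L i j))

  Gen : Fin 5 → Mat N
  Gen = five E₀ T E₂ K L̃

  L̃-entry : ∀ i x j y → L̃ (pair i x) (pair j y) ≡ C (L i j) x y
  L̃-entry = block-entry (λ i j → C (L i j))

  L-zero : ∀ i j → L i j ≡ zero → i ≡ j
  L-zero i j e = sym (proj₁ L-latin i (trans e (sym (L-diag i))))

  L-separates : ∀ {i j} → i ≢ j → ∀ k → L i k ≢ L k j
  L-separates i≢j k e = i≢j (proj₂ L-latin k (trans e (L-sym k _)))

  -- The blocks of L̃ square to those of K, since C_s (s ≠ 0) has ±1 entries.
  L̃-square : ∀ i x j y → C (L i j) x y * C (L i j) x y ≡ J-I i j * + 1
  L̃-square i x j y = by-cases (i Fin.≟ j) (L i j) refl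
    where
    by-cases : Dec (i ≡ j) → ∀ s → L i j ≡ s → C s x y * C s x y ≡ J-I i j * + 1
    by-cases (yes refl) s e with refl ← trans (sym e) (L-diag i) = cong (λ δ → (+ 1 - δ) * + 1) (sym (I-diag i))
    by-cases (no i≢j) zero    e = contradiction (L-zero i j e) i≢j
    by-cases (no i≢j) (suc k) e =
      trans (PM1-square (rowOuter-±1 (inject≤ k le) x y)) (cong (λ δ → (+ 1 - δ) * + 1) (sym (I-off i≢j)))

  E₂-decomposition : E₂ ≐ (𝔸 0F +ₘ 𝔸 1F +ₘ 𝔸 2F)
  E₂-decomposition = ≐-by-blocks λ i x j y → begin
    E₂ (pair i x) (pair j y) ≡⟨ ⊗-entry (Iₘ p) (Jₘ n) i x j y ⟩
    Iₘ p i j * + 1           ≡⟨ split (Iₘ p i j) (Iₘ n x y) (A x y) ⟩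
    Iₘ p i j * Iₘ n x y + Iₘ p i j * A x y + Iₘ p i j * Ā x y
      ≡⟨ sym (cong₂ _+_ (cong₂ _+_ (I-entry i x j y) (⊗-entry (Iₘ p) A i x j y))
                        (⊗-entry (Iₘ p) Ā i x j y)) ⟩
    (𝔸 0F +ₘ 𝔸 1F +ₘ 𝔸 2F) (pair i x) (pair j y) ∎
    where
    open ≡-Reasoning
    split : ∀ δ ι α → δ * + 1 ≡ δ * ι + δ * α + δ * (+ 1 - α - ι)
    split = solve-∀

  S≐ : ∀ x y → S x y ≡ + ℓ * Iₘ n x y + a * A x y + b * Ā x y
  S≐ x y = trans (ℤP.+-identityˡ _) (S-decomp x y)

  T-decomposition : T ≐ ((+ ℓ - b) ·ₛ 𝔸 0F +ₘ (a - b) ·ₛ 𝔸 1F +ₘ b ·ₛ E₂)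
  T-decomposition = ≐-by-blocks λ i x j y → begin
    T (pair i x) (pair j y) ≡⟨ ⊗-entry (Iₘ p) S i x j y ⟩
    Iₘ p i j * S x y        ≡⟨ cong (Iₘ p i j *_) (S≐ x y) ⟩
    Iₘ p i j * (+ ℓ * Iₘ n x y + a * A x y + b * (+ 1 - A x y - Iₘ n x y))
      ≡⟨ regroup (Iₘ p i j) (Iₘ n x y) (A x y) (+ ℓ) a b ⟩
    (+ ℓ - b) * (Iₘ p i j * Iₘ n x y) + (a - b) * (Iₘ p i j * A x y) + b * (Iₘ p i j * + 1)
      ≡⟨ sym (cong₂ _+_ (cong₂ _+_ (cong ((+ ℓ - b) *_) (I-entry i x j y))
                                    (cong ((a - b) *_) (⊗-entry (Iₘ p) A i x j y)))
                         (cong (b *_) (⊗-entry (Iₘ p) (Jₘ n) i x j y))) ⟩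
    ((+ ℓ - b) ·ₛ 𝔸 0F +ₘ (a - b) ·ₛ 𝔸 1F +ₘ b ·ₛ E₂) (pair i x) (pair j y) ∎
    where
    open ≡-Reasoning
    regroup : ∀ δ ι α l a b → δ * (l * ι + a * α + b * (+ 1 - α - ι))
                            ≡ (l - b) * (δ * ι) + (a - b) * (δ * α) + b * (δ * + 1)
    regroup = solve-∀

  K-decomposition : K ≐ (A₃ +ₘ A₄)
  K-decomposition = ≐-by-blocks λ i x j y → begin
    K (pair i x) (pair j y)       ≡⟨ ⊗-entry J-I (Jₘ n) i x j y ⟩
    J-I i j * + 1                 ≡⟨ sym (L̃-square i x j y) ⟩
    C (L i j) x y * C (L i j) x y ≡⟨ cong (λ e → e * e) (trans (sym (L̃-entry i x j y)) (L̃≐A₃-A₄ _ _)) ⟩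
    (A₃ (pair i x) (pair j y) - A₄ (pair i x) (pair j y))
      * (A₃ (pair i x) (pair j y) - A₄ (pair i x) (pair j y))
      ≡⟨ disjoint-square (A₃-01 _ _) (A₄-01 _ _) (disjoint _ _) ⟩
    (A₃ +ₘ A₄) (pair i x) (pair j y) ∎
    where open ≡-Reasoning

  L̃-decomposition : L̃ ≐ (A₃ +ₘ (- + 1) ·ₛ A₄)
  L̃-decomposition u v = trans (L̃≐A₃-A₄ u v) (minus (A₃ u v) (A₄ u v))
    where
    minus : ∀ s t → s - t ≡ s + (- + 1) * t
    minus = solve-∀

  𝔸₁-combination : ((a - b) ·ₛ 𝔸 1F) ≐ (T +ₘ (- (+ ℓ - b)) ·ₛ E₀ +ₘ (- b) ·ₛ E₂)
  𝔸₁-combination u v =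
    trans (solve-for-𝔸₁ (+ ℓ) a b (E₀ u v) (𝔸 1F u v) (E₂ u v))
          (cong (λ t → t + (- (+ ℓ - b)) * E₀ u v + (- b) * E₂ u v) (sym (T-decomposition u v)))
    where
    solve-for-𝔸₁ : ∀ l a b e₀ x e₂ →
      (a - b) * x ≡ ((l - b) * e₀ + (a - b) * x + b * e₂) + (- (l - b)) * e₀ + (- b) * e₂
    solve-for-𝔸₁ = solve-∀

  𝔸₂-combination : 𝔸 2F ≐ (E₂ +ₘ (- + 1) ·ₛ 𝔸 0F +ₘ (- + 1) ·ₛ 𝔸 1F)
  𝔸₂-combination u v =
    trans (solve-for-𝔸₂ (𝔸 0F u v) (𝔸 1F u v) (𝔸 2F u v))
          (cong (λ t → t + (- + 1) * 𝔸 0F u v + (- + 1) * 𝔸 1F u v) (sym (E₂-decomposition u v)))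
    where
    solve-for-𝔸₂ : ∀ x₀ x₁ x₂ → x₂ ≡ (x₀ + x₁ + x₂) + (- + 1) * x₀ + (- + 1) * x₁
    solve-for-𝔸₂ = solve-∀

  A₃-combination : (+ 2 ·ₛ A₃) ≐ (K +ₘ L̃)
  A₃-combination u v =
    trans (solve-for-A₃ (A₃ u v) (A₄ u v)) (sym (cong₂ _+_ (K-decomposition u v) (L̃-decomposition u v)))
    where
    solve-for-A₃ : ∀ s t → + 2 * s ≡ (s + t) + (s + (- + 1) * t)
    solve-for-A₃ = solve-∀

  A₄-combination : (+ 2 ·ₛ A₄) ≐ (K +ₘ (- + 1) ·ₛ L̃)
  A₄-combination u v =
    trans (solve-for-A₄ (A₃ u v) (A₄ u v))
          (sym (cong₂ (λ k l → k + (- + 1) * l) (K-decomposition u v) (L̃-decomposition u v)))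
    where
    solve-for-A₄ : ∀ s t → + 2 * t ≡ (s + t) + (- + 1) * (s + (- + 1) * t)
    solve-for-A₄ = solve-∀

  a-b≢0 : a - b ≢ + 0
  a-b≢0 e = a≢b (ℤP.i-j≡0⇒i≡j a b e)

  relations-in-span : ∀ {Q} → LinClosed Q → (∀ g → Q (Gen g)) → ∀ k → Q (𝔸 k)
  relations-in-span lin q 0F = q 0F
  relations-in-span lin q 1F =
    cancel (a - b) a-b≢0 (respects (≐-sym 𝔸₁-combination)
      (plus (plus (q 1F) (scale (- (+ ℓ - b)) (q 0F))) (scale (- b) (q 2F))))
    where open LinClosed lin
  relations-in-span lin q 2F =
    respects (≐-sym 𝔸₂-combination)
      (plus (plus (q 2F) (scale (- + 1) (q 0F))) (scale (- + 1) (relations-in-span lin q 1F)))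
    where open LinClosed lin
  relations-in-span lin q 3F =
    cancel (+ 2) (λ ()) (respects (≐-sym A₃-combination) (plus (q 3F) (q 4F)))
    where open LinClosed lin
  relations-in-span lin q 4F =
    cancel (+ 2) (λ ()) (respects (≐-sym A₄-combination)
      (plus (q 3F) (scale (- + 1) (q 4F))))
    where open LinClosed lin

  cc-via : ∀ {X Y} → X ≐ Y → ClassConstant Y → ClassConstant X
  cc-via e = LinClosed.respects classConstant-lin (≐-sym e)

  open LinClosed classConstant-lin using () renaming (plus to cc-plus; scale to cc-scale)

  generator-classConstant : ∀ g → ClassConstant (Gen g)
  generator-classConstant 0F = relation-classConstant 0F
  generator-classConstant 1F =
    cc-via T-decomposition
      (cc-plus (cc-plus (cc-scale (+ ℓ - b) (relation-classConstant 0F))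
                        (cc-scale (a - b) (relation-classConstant 1F)))
               (cc-scale b (generator-classConstant 2F)))
  generator-classConstant 2F =
    cc-via E₂-decomposition
      (cc-plus (cc-plus (relation-classConstant 0F) (relation-classConstant 1F)) (relation-classConstant 2F))
  generator-classConstant 3F =
    cc-via K-decomposition (cc-plus (relation-classConstant 3F) (relation-classConstant 4F))
  generator-classConstant 4F =
    cc-via L̃-decomposition (cc-plus (relation-classConstant 3F) (cc-scale (- + 1) (relation-classConstant 4F)))

  J-I-symmetric : IsSymmetric J-I
  J-I-symmetric i j = cong (λ δ → + 1 - δ) (I-sym i j)

  generator-symmetric : ∀ g → IsSymmetric (Gen g)
  generator-symmetric 0F = I-sym
  generator-symmetric 1F = ⊗-symmetric I-sym S-symmetric
  generator-symmetric 2F = ⊗-symmetric I-sym J-symmetric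
  generator-symmetric 3F = ⊗-symmetric J-I-symmetric J-symmetric
  generator-symmetric 4F = symmetric-by-blocks λ i x j y → begin
    L̃ (pair j y) (pair i x) ≡⟨ L̃-entry j y i x ⟩
    C (L j i) y x            ≡⟨ cong (λ s → C s y x) (L-sym j i) ⟩
    C (L i j) y x            ≡⟨ C-symmetric (L i j) x y ⟩
    C (L i j) x y            ≡⟨ sym (L̃-entry i x j y) ⟩
    L̃ (pair i x) (pair j y) ∎
    where open ≡-Reasoning

  𝔸-symmetric : ∀ k → IsSymmetric (𝔸 k)
  𝔸-symmetric = relations-in-span symmetric-lin generator-symmetric

  J-I-column : ∀ j → sumFin p (λ k → + 1 - Iₘ p k j) ≡ + ℓ
  J-I-column j = begin
    sumFin p (λ k → + 1 - Iₘ p k j)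
      ≡⟨ sum-cong p (λ k → as-sum (Iₘ p k j)) ⟩
    sumFin p (λ k → + 1 + (- + 1) * (+ 1 * Iₘ p k j))
      ≡⟨ sum-+ p (λ _ → + 1) (λ k → (- + 1) * (+ 1 * Iₘ p k j)) ⟩
    sumFin p (λ _ → + 1) + sumFin p (λ k → (- + 1) * (+ 1 * Iₘ p k j))
      ≡⟨ cong₂ _+_ (sum-const p (+ 1))
                   (trans (sum-*ˡ p (- + 1) (λ k → + 1 * Iₘ p k j))
                          (cong ((- + 1) *_) (sum-δʳ p j (λ _ → + 1)))) ⟩
    + p * + 1 + (- + 1) * + 1 ≡⟨ count (+ ℓ) ⟩
    + ℓ                       ∎
    where
    open ≡-Reasoning
    as-sum : ∀ δ → + 1 - δ ≡ + 1 + (- + 1) * (+ 1 * δ)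
    as-sum = solve-∀
    count : ∀ l → (+ 1 + l) * + 1 + (- + 1) * + 1 ≡ l
    count = solve-∀

  J-I-square : ∀ i j → (J-I · J-I) i j ≡ (+ ℓ - + 1) + Iₘ p i j
  J-I-square i j = begin
    sumFin p (λ k → (+ 1 - Iₘ p i k) * (+ 1 - Iₘ p k j))
      ≡⟨ sum-cong p (λ k → expand (Iₘ p i k) (Iₘ p k j)) ⟩
    sumFin p (λ k → (+ 1 - Iₘ p k j) + (- + 1) * (Iₘ p i k * (+ 1 - Iₘ p k j)))
      ≡⟨ sum-+ p (λ k → + 1 - Iₘ p k j) (λ k → (- + 1) * (Iₘ p i k * (+ 1 - Iₘ p k j))) ⟩
    sumFin p (λ k → + 1 - Iₘ p k j) + sumFin p (λ k → (- + 1) * (Iₘ p i k * (+ 1 - Iₘ p k j)))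
      ≡⟨ cong₂ _+_ (J-I-column j)
                   (trans (sum-*ˡ p (- + 1) (λ k → Iₘ p i k * (+ 1 - Iₘ p k j)))
                          (cong ((- + 1) *_) (sum-δ p i (λ k → + 1 - Iₘ p k j)))) ⟩
    + ℓ + (- + 1) * (+ 1 - Iₘ p i j) ≡⟨ collect (+ ℓ) (Iₘ p i j) ⟩
    (+ ℓ - + 1) + Iₘ p i j           ∎
    where
    open ≡-Reasoning
    expand : ∀ u w → (+ 1 - u) * (+ 1 - w) ≡ (+ 1 - w) + (- + 1) * (u * (+ 1 - w))
    expand = solve-∀
    collect : ∀ l δ → l + (- + 1) * (+ 1 - δ) ≡ (l - + 1) + δ
    collect = solve-∀

  T·T : (T · T) ≐ (+ n ·ₛ T)
  T·T = ⊗-product-scaled (Iₘ p) S (Iₘ p) S (+ n) (I·M (Iₘ p)) S·S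

  T·E₂ : (T · E₂) ≐ Oₘ N
  T·E₂ = ⊗-product-zero (Iₘ p) S (Iₘ p) (Jₘ n) S·J

  T·K : (T · K) ≐ Oₘ N
  T·K = ⊗-product-zero (Iₘ p) S J-I (Jₘ n) S·J

  E₂·E₂ : (E₂ · E₂) ≐ (+ n ·ₛ E₂)
  E₂·E₂ = ⊗-product-scaled (Iₘ p) (Jₘ n) (Iₘ p) (Jₘ n) (+ n) (I·M (Iₘ p)) J·J

  E₂·K : (E₂ · K) ≐ (+ n ·ₛ K)
  E₂·K = ⊗-product-scaled (Iₘ p) (Jₘ n) J-I (Jₘ n) (+ n) (I·M J-I) J·J

  K·K : (K · K) ≐ ((+ n * (+ ℓ - + 1)) ·ₛ K +ₘ (+ n * + ℓ) ·ₛ E₂)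
  K·K = ≐-by-blocks λ i x j y → begin
    (K · K) (pair i x) (pair j y)          ≡⟨ ⊗-product J-I (Jₘ n) J-I (Jₘ n) i x j y ⟩
    (J-I · J-I) i j * (Jₘ n · Jₘ n) x y    ≡⟨ cong₂ _*_ (J-I-square i j) (J·J x y) ⟩
    ((+ ℓ - + 1) + Iₘ p i j) * (+ n * + 1) ≡⟨ regroup (+ ℓ) (+ n) (Iₘ p i j) ⟩
    (+ n * (+ ℓ - + 1)) * ((+ 1 - Iₘ p i j) * + 1) + (+ n * + ℓ) * (Iₘ p i j * + 1)
      ≡⟨ sym (cong₂ (λ k e → (+ n * (+ ℓ - + 1)) * k + (+ n * + ℓ) * e)
                    (⊗-entry J-I (Jₘ n) i x j y) (⊗-entry (Iₘ p) (Jₘ n) i x j y)) ⟩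
    ((+ n * (+ ℓ - + 1)) ·ₛ K +ₘ (+ n * + ℓ) ·ₛ E₂) (pair i x) (pair j y) ∎
    where
    open ≡-Reasoning
    regroup : ∀ l m δ → ((l - + 1) + δ) * (m * + 1) ≡ (m * (l - + 1)) * ((+ 1 - δ) * + 1) + (m * l) * (δ * + 1)
    regroup = solve-∀

  T·L̃ : (T · L̃) ≐ (+ n ·ₛ L̃)
  T·L̃ = ≐-by-blocks λ i x j y → begin
    (T · L̃) (pair i x) (pair j y)
      ≡⟨ ⊗·block (Iₘ p) S (λ i j → C (L i j)) i x j y ⟩
    sumFin p (λ k → Iₘ p i k * (S · C (L k j)) x y)
      ≡⟨ sum-cong p (λ k → cong (Iₘ p i k *_) (S·C (L k j) x y)) ⟩
    sumFin p (λ k → Iₘ p i k * (+ n * C (L k j) x y))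
      ≡⟨ sum-δ p i (λ k → + n * C (L k j) x y) ⟩
    + n * C (L i j) x y
      ≡⟨ cong (+ n *_) (sym (L̃-entry i x j y)) ⟩
    (+ n ·ₛ L̃) (pair i x) (pair j y) ∎
    where open ≡-Reasoning

  E₂·L̃ : (E₂ · L̃) ≐ Oₘ N
  E₂·L̃ = ⊗·block-zero (Iₘ p) (Jₘ n) (λ i j → C (L i j)) (λ k j → J·C (L k j))

  K·L̃ : (K · L̃) ≐ Oₘ N
  K·L̃ = ⊗·block-zero J-I (Jₘ n) (λ i j → C (L i j)) (λ k j → J·C (L k j))

  -- Row i of L runs through every symbol once.
  L-row-sum : ∀ i x y → sumFin p (λ k → C (L i k) x y) ≡ S x y
  L-row-sum i x y = sum-permute p (L i) (proj₁ L-latin i) (λ s → C s x y)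

  -- Blocks of L̃²: off the diagonal every product C_{L i k} C_{L k j} vanishes.
  L̃²-block : ∀ i x j y →
    sumFin p (λ k → (+ n * Iₘ p (L i k) (L k j)) * C (L i k) x y) ≡ + n * (Iₘ p i j * S x y)
  L̃²-block i x j y = by-cases (i Fin.≟ j)
    where
    open ≡-Reasoning
    by-cases : Dec (i ≡ j) →
      sumFin p (λ k → (+ n * Iₘ p (L i k) (L k j)) * C (L i k) x y) ≡ + n * (Iₘ p i j * S x y)
    by-cases (yes refl) = begin
      sumFin p (λ k → (+ n * Iₘ p (L i k) (L k i)) * C (L i k) x y)
        ≡⟨ sum-cong p (λ k → cong (λ δ → (+ n * δ) * C (L i k) x y)
                                  (trans (cong (Iₘ p (L i k)) (L-sym k i)) (I-diag (L i k)))) ⟩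
      sumFin p (λ k → (+ n * + 1) * C (L i k) x y)
        ≡⟨ sum-*ˡ p (+ n * + 1) (λ k → C (L i k) x y) ⟩
      (+ n * + 1) * sumFin p (λ k → C (L i k) x y)
        ≡⟨ cong (λ δ → (+ n * δ) * sumFin p (λ k → C (L i k) x y)) (sym (I-diag i)) ⟩
      (+ n * Iₘ p i i) * sumFin p (λ k → C (L i k) x y)
        ≡⟨ cong ((+ n * Iₘ p i i) *_) (L-row-sum i x y) ⟩
      (+ n * Iₘ p i i) * S x y
        ≡⟨ ℤP.*-assoc (+ n) (Iₘ p i i) (S x y) ⟩
      + n * (Iₘ p i i * S x y) ∎
    by-cases (no i≢j) = begin
      sumFin p (λ k → (+ n * Iₘ p (L i k) (L k j)) * C (L i k) x y)
        ≡⟨ sum-zero p (λ k → trans (cong (λ δ → (+ n * δ) * C (L i k) x y) (I-off (L-separates i≢j k)))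
                                    (vanish (+ n) (C (L i k) x y))) ⟩
      + 0
        ≡⟨ sym (trans (cong (λ δ → + n * (δ * S x y)) (I-off i≢j)) (vanish' (+ n) (S x y))) ⟩
      + n * (Iₘ p i j * S x y) ∎
      where
      vanish : ∀ m c → (m * + 0) * c ≡ + 0
      vanish = solve-∀
      vanish' : ∀ m s → m * (+ 0 * s) ≡ + 0
      vanish' = solve-∀

  L̃·L̃ : (L̃ · L̃) ≐ (+ n ·ₛ T)
  L̃·L̃ = ≐-by-blocks λ i x j y → begin
    (L̃ · L̃) (pair i x) (pair j y)
      ≡⟨ block·block (λ i j → C (L i j)) (λ i j → C (L i j)) i x j y ⟩
    sumFin p (λ k → (C (L i k) · C (L k j)) x y)
      ≡⟨ sum-cong p (λ k → C-product (L i k) (L k j) x y) ⟩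
    sumFin p (λ k → (+ n * Iₘ p (L i k) (L k j)) * C (L i k) x y)
      ≡⟨ L̃²-block i x j y ⟩
    + n * (Iₘ p i j * S x y)
      ≡⟨ cong (+ n *_) (sym (⊗-entry (Iₘ p) S i x j y)) ⟩
    (+ n ·ₛ T) (pair i x) (pair j y) ∎
    where open ≡-Reasoning

  zero-classConstant : ClassConstant (Oₘ N)
  zero-classConstant u v u' v' same = refl

  -- Products of symmetric generators in the opposite order are transposes.
  transposed : ∀ g g' → ClassConstant (Gen g' · Gen g) → ClassConstant (Gen g · Gen g')
  transposed g g' = classConstant-swap 𝔸-symmetric (generator-symmetric g) (generator-symmetric g')

  generator-products : ∀ g g' → ClassConstant (Gen g · Gen g')
  generator-products 0F g' = cc-via (I·M (Gen g')) (generator-classConstant g')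
  generator-products g  0F = cc-via (M·I (Gen g)) (generator-classConstant g)
  generator-products 1F 1F = cc-via T·T (cc-scale (+ n) (generator-classConstant 1F))
  generator-products 1F 2F = cc-via T·E₂ zero-classConstant
  generator-products 1F 3F = cc-via T·K zero-classConstant
  generator-products 1F 4F = cc-via T·L̃ (cc-scale (+ n) (generator-classConstant 4F))
  generator-products 2F 2F = cc-via E₂·E₂ (cc-scale (+ n) (generator-classConstant 2F))
  generator-products 2F 3F = cc-via E₂·K (cc-scale (+ n) (generator-classConstant 3F))
  generator-products 2F 4F = cc-via E₂·L̃ zero-classConstant
  generator-products 3F 3F =
    cc-via K·K (cc-plus (cc-scale (+ n * (+ ℓ - + 1)) (generator-classConstant 3F))
                        (cc-scale (+ n * + ℓ) (generator-classConstant 2F)))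
  generator-products 3F 4F = cc-via K·L̃ zero-classConstant
  generator-products 4F 4F = cc-via L̃·L̃ (cc-scale (+ n) (generator-classConstant 1F))
  generator-products 2F 1F = transposed 2F 1F (generator-products 1F 2F)
  generator-products 3F 1F = transposed 3F 1F (generator-products 1F 3F)
  generator-products 3F 2F = transposed 3F 2F (generator-products 2F 3F)
  generator-products 4F 1F = transposed 4F 1F (generator-products 1F 4F)
  generator-products 4F 2F = transposed 4F 2F (generator-products 2F 4F)
  generator-products 4F 3F = transposed 4F 3F (generator-products 3F 4F)

  -- The relations lie in the rational span of the generators, so class-constancy
  -- passes from products of generators to products of relations.
  relation-products : ∀ i j → ClassConstant (𝔸 i · 𝔸 j)
  relation-products i j =
    relations-in-span (·-closedʳ classConstant-lin (𝔸 i))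
      (λ g → relations-in-span (·-closedˡ classConstant-lin (Gen g)) (λ g' → generator-products g' g) i)
      j

  Ā-01 : Is01 Ā
  Ā-01 x y = by-cases (x Fin.≟ y)
    where
    by-cases : Dec (x ≡ y) → Z01 (Ā x y)
    by-cases (yes refl) = inj₁ (cong₂ (λ α δ → + 1 - α - δ) (A-diag x) (I-diag x))
    by-cases (no x≢y) with A-01 x y
    ... | inj₁ A≡0 = inj₂ (cong₂ (λ α δ → + 1 - α - δ) A≡0 (I-off x≢y))
    ... | inj₂ A≡1 = inj₁ (cong₂ (λ α δ → + 1 - α - δ) A≡1 (I-off x≢y))

  I⊗-01 : ∀ {Q} → Is01 Q → Is01 (Iₘ p ⊗ Q)
  I⊗-01 {Q} Q-01 = by-blocks (λ u v → Z01 ((Iₘ p ⊗ Q) u v)) λ i x j y →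
    subst Z01 (sym (⊗-entry (Iₘ p) Q i x j y)) (Z01-* (I-01 i j) (Q-01 x y))

  𝔸-01 : ∀ k → Is01 (𝔸 k)
  𝔸-01 0F = I-01
  𝔸-01 1F = I⊗-01 A-01
  𝔸-01 2F = I⊗-01 Ā-01
  𝔸-01 3F = A₃-01
  𝔸-01 4F = A₄-01

  partition : (λ u v → sumFin 5 (λ k → 𝔸 k u v)) ≐ Jₘ N
  partition u v = begin
    𝔸 0F u v + (𝔸 1F u v + (𝔸 2F u v + (A₃ u v + (A₄ u v + + 0))))
      ≡⟨ regroup (𝔸 0F u v) (𝔸 1F u v) (𝔸 2F u v) (A₃ u v) (A₄ u v) ⟩
    (𝔸 0F u v + 𝔸 1F u v + 𝔸 2F u v) + (A₃ u v + A₄ u v)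
      ≡⟨ cong₂ _+_ (sym (E₂-decomposition u v)) (sym (K-decomposition u v)) ⟩
    E₂ u v + K u v
      ≡⟨ by-blocks (λ u v → E₂ u v + K u v ≡ + 1) E₂+K u v ⟩
    + 1 ∎
    where
    open ≡-Reasoning
    regroup : ∀ x₀ x₁ x₂ x₃ x₄ → x₀ + (x₁ + (x₂ + (x₃ + (x₄ + + 0)))) ≡ (x₀ + x₁ + x₂) + (x₃ + x₄)
    regroup = solve-∀
    complement : ∀ δ → δ * + 1 + (+ 1 - δ) * + 1 ≡ + 1
    complement = solve-∀
    E₂+K : ∀ i x j y → E₂ (pair i x) (pair j y) + K (pair i x) (pair j y) ≡ + 1
    E₂+K i x j y =
      trans (cong₂ _+_ (⊗-entry (Iₘ p) (Jₘ n) i x j y) (⊗-entry J-I (Jₘ n) i x j y))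
            (complement (Iₘ p i j))

  module Witnesses (0<ℓ : 0 < ℓ) (ℓ<n-1 : ℓ < n ∸ 1) where

    0<n : 0 < n
    0<n = ℕP.<-trans 0<ℓ (ℕP.<-≤-trans ℓ<n-1 (ℕP.m∸n≤m n 1))

    x₀ : Fin n
    x₀ = Fin.fromℕ< 0<n

    j₁ : Fin p
    j₁ = suc (Fin.fromℕ< 0<ℓ)

    u₀ : Fin N
    u₀ = pair 0F x₀

    -- Row x₀ of S is not ℓ on the diagonal and constant elsewhere, because its
    -- entries sum to zero (S J = O).
    no-constant-row : ∀ c → ¬ (∀ y → S x₀ y ≡ + ℓ * Iₘ n x₀ y + c * (+ 1 - Iₘ n x₀ y))
    no-constant-row c row = row-sum≢0 {ℓ} {n} 0<ℓ ℓ<n-1 c (begin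
      + n * c + (+ ℓ - c) * + 1
        ≡⟨ sym (cong₂ _+_ (sum-const n c) (trans (sum-*ˡ n (+ ℓ - c) (λ y → Iₘ n x₀ y * + 1))
                                                  (cong ((+ ℓ - c) *_) (sum-δ n x₀ (λ _ → + 1))))) ⟩
      sumFin n (λ _ → c) + sumFin n (λ y → (+ ℓ - c) * (Iₘ n x₀ y * + 1))
        ≡⟨ sym (sum-+ n (λ _ → c) (λ y → (+ ℓ - c) * (Iₘ n x₀ y * + 1))) ⟩
      sumFin n (λ y → c + (+ ℓ - c) * (Iₘ n x₀ y * + 1))
        ≡⟨ sum-cong n (λ y → sym (trans (cong (_* + 1) (row y)) (regroup (+ ℓ) (Iₘ n x₀ y) c))) ⟩
      (S · Jₘ n) x₀ x₀
        ≡⟨ S·J x₀ x₀ ⟩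
      + 0 ∎)
      where
      open ≡-Reasoning
      regroup : ∀ l δ c → (l * δ + c * (+ 1 - δ)) * + 1 ≡ c + (l - c) * (δ * + 1)
      regroup = solve-∀

    A-row : ∃[ y ] A x₀ y ≡ + 1
    A-row = two-valued (A x₀) (A-01 x₀) λ A≡0 → no-constant-row b λ y → begin
      S x₀ y
        ≡⟨ S≐ x₀ y ⟩
      + ℓ * Iₘ n x₀ y + a * A x₀ y + b * (+ 1 - A x₀ y - Iₘ n x₀ y)
        ≡⟨ cong (λ α → + ℓ * Iₘ n x₀ y + a * α + b * (+ 1 - α - Iₘ n x₀ y)) (A≡0 y) ⟩
      + ℓ * Iₘ n x₀ y + a * + 0 + b * (+ 1 - + 0 - Iₘ n x₀ y)
        ≡⟨ drop-A (+ ℓ) (Iₘ n x₀ y) a b ⟩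
      + ℓ * Iₘ n x₀ y + b * (+ 1 - Iₘ n x₀ y) ∎
      where
      open ≡-Reasoning
      drop-A : ∀ l δ a b → l * δ + a * + 0 + b * (+ 1 - + 0 - δ) ≡ l * δ + b * (+ 1 - δ)
      drop-A = solve-∀

    Ā-row : ∃[ y ] Ā x₀ y ≡ + 1
    Ā-row = two-valued (Ā x₀) (Ā-01 x₀) λ Ā≡0 → no-constant-row a λ y → begin
      S x₀ y                                    ≡⟨ S≐ x₀ y ⟩
      + ℓ * Iₘ n x₀ y + a * A x₀ y + b * Ā x₀ y ≡⟨ shift (+ ℓ) (Iₘ n x₀ y) a b (A x₀ y) ⟩
      (+ ℓ * Iₘ n x₀ y + a * (+ 1 - Iₘ n x₀ y)) + (b - a) * Ā x₀ y
        ≡⟨ cong (λ ā → (+ ℓ * Iₘ n x₀ y + a * (+ 1 - Iₘ n x₀ y)) + (b - a) * ā) (Ā≡0 y) ⟩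
      (+ ℓ * Iₘ n x₀ y + a * (+ 1 - Iₘ n x₀ y)) + (b - a) * + 0
        ≡⟨ drop-Ā _ (b - a) ⟩
      + ℓ * Iₘ n x₀ y + a * (+ 1 - Iₘ n x₀ y) ∎
      where
      open ≡-Reasoning
      shift : ∀ l δ a b α →
        l * δ + a * α + b * (+ 1 - α - δ) ≡ (l * δ + a * (+ 1 - δ)) + (b - a) * (+ 1 - α - δ)
      shift = solve-∀
      drop-Ā : ∀ s d → s + d * + 0 ≡ s
      drop-Ā = solve-∀

    -- Row x₀ of each C_{k+1} contains a −1: otherwise C_{k+1} J would have the
    -- entry n ≠ 0.
    C-row : ∀ k → ∃[ y ] C (suc k) x₀ y ≡ - + 1
    C-row k = two-valued (C (suc k) x₀) (rowOuter-±1 (inject≤ k le) x₀) λ all-one →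
      n≢0 (begin
        + n                      ≡⟨ sym (ℤP.*-identityʳ (+ n)) ⟩
        + n * + 1                ≡⟨ sym (sum-const n (+ 1)) ⟩
        sumFin n (λ _ → + 1)     ≡⟨ sum-cong n (λ y → cong (_* + 1) (sym (all-one y))) ⟩
        (C (suc k) · Jₘ n) x₀ x₀ ≡⟨ C·J (suc k) x₀ x₀ ⟩
        + 0                      ∎)
      where
      open ≡-Reasoning
      n≢0 : + n ≢ + 0
      n≢0 e = ℕP.<⇒≢ 0<n (sym (ℤP.+-injective e))

    -- The block (0 , j₁) of L̃ is C_{k+1} for some k, as j₁ is off the diagonal.
    off-diagonal-symbol : ∃[ k ] L 0F j₁ ≡ suc k
    off-diagonal-symbol with L 0F j₁ in e
    ... | zero  = contradiction (L-zero 0F j₁ e) (λ ())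
    ... | suc k = k , refl

    k₁ : Fin ℓ
    k₁ = proj₁ off-diagonal-symbol

    L̃-at : ∀ y → A₃ u₀ (pair j₁ y) - A₄ u₀ (pair j₁ y) ≡ C (suc k₁) x₀ y
    L̃-at y = trans (sym (L̃≐A₃-A₄ u₀ (pair j₁ y)))
                   (trans (L̃-entry 0F x₀ j₁ y) (cong (λ s → C s x₀ y) (proj₂ off-diagonal-symbol)))

    -- Representative pairs: (u₀ , u₀); pairs inside block 0 where A resp. Ā
    -- is 1; pairs in block (0 , j₁) where C_{k₁+1} is 1 resp. −1.
    witness : ∀ k → ∃₂ λ u v → 𝔸 k u v ≡ + 1
    witness 0F = u₀ , u₀ , I-diag u₀
    witness 1F = u₀ , pair 0F (proj₁ A-row) ,
      trans (⊗-entry (Iₘ p) A 0F x₀ 0F (proj₁ A-row)) (cong₂ _*_ (I-diag {p} 0F) (proj₂ A-row))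
    witness 2F = u₀ , pair 0F (proj₁ Ā-row) ,
      trans (⊗-entry (Iₘ p) Ā 0F x₀ 0F (proj₁ Ā-row)) (cong₂ _*_ (I-diag {p} 0F) (proj₂ Ā-row))
    witness 3F = u₀ , pair j₁ x₀ ,
      bit-difference-one (A₃-01 _ _) (A₄-01 _ _) (trans (L̃-at x₀) (rowOuter-diagonal (inject≤ k₁ le) x₀))
    witness 4F = u₀ , pair j₁ (proj₁ (C-row k₁)) ,
      bit-difference-minus-one (A₃-01 _ _) (A₄-01 _ _) (trans (L̃-at (proj₁ (C-row k₁))) (proj₂ (C-row k₁)))

    isSymAssocScheme : IsSymAssocScheme N 4 𝔸
    isSymAssocScheme =
      Criterion.isSymAssocScheme 𝔸-01 partition (λ u v → refl) 𝔸-symmetric witness relation-products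

theorem5p6 : (n ℓ : ℕ) (H : Mat n) → IsHadamard n H
    → (∃[ k ] ℓ ≡ suc (2 ℕ.* k)) → 1 < ℓ → (ℓn : ℓ < n ∸ 1)
    → (a b : ℤ) → a ≢ b → (A : Mat n) → Is01 A → IsSymmetric A → (∀ x → A x x ≡ + 0)
    → ((λ x y → sumFin ℓ (λ k → rowOuter H (inject≤ k (<∸1⇒≤ ℓn)) x y))
        ≐ (λ x y → + ℓ * Iₘ n x y + a * A x y + b * (Jₘ n x y - A x y - Iₘ n x y)))
    → (∀ (k : Fin ℓ) → (rowOuter H (inject≤ k (<∸1⇒≤ ℓn)) · Jₘ n) ≐ Oₘ n)
    → (L : Fin (suc ℓ) → Fin (suc ℓ) → Fin (suc ℓ)) → IsLatinSquare L
    → (∀ i j → L i j ≡ L j i) → (∀ i → L i i ≡ zero)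
    → (A3 A4 : Mat (suc ℓ ℕ.* n)) → Is01 A3 → Is01 A4
    → (∀ u v → A3 u v * A4 u v ≡ + 0)
    → (blockMat (λ i j → symC (<∸1⇒≤ ℓn) H (L i j)) ≐ (λ u v → A3 u v - A4 u v))
    → IsSymAssocScheme (suc ℓ ℕ.* n) 4
        (five (Iₘ (suc ℓ ℕ.* n))
              (Iₘ (suc ℓ) ⊗ A)
              (Iₘ (suc ℓ) ⊗ (λ x y → Jₘ n x y - A x y - Iₘ n x y))
              A3 A4)
theorem5p6 n ℓ H hH _ 1<ℓ ℓn a b a≢b A A-01 _ A-diag S-decomp C·J≐O
           L L-latin L-sym L-diag A₃ A₄ A₃-01 A₄-01 disjoint L̃≐A₃-A₄ =
  Witnesses.isSymAssocScheme (ℕP.<⇒≤ 1<ℓ) ℓn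
  where
  open Construction H hH (<∸1⇒≤ ℓn) C·J≐O a b a≢b A A-01 A-diag S-decomp
                    L L-latin L-sym L-diag A₃ A₄ A₃-01 A₄-01 disjoint L̃≐A₃-A₄
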